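{- Suppose that $F$ preserves 1/4-iso pullbacks. Then: (1) $\underline{F}$-bisimilarity is sound and complete. (2) If $F$ weakly preserves pullbacks, then the $\underline{F}$-bisimulations are precisely the $\overline{F}$-bisimulations up to difunctionality.
   Context: $F\colon \mathbf{Set}\to\mathbf{Set}$ is a functor. Relations $r\subseteq X\times Y$ are composed applicatively ($s\cdot r=\{(x,z)\mid \exists y.\ x\,r\,y\,s\,z\}$), $r^\circ$ is the converse, functions are regarded as relations. An $F$-relator $R$ is a monotone assignment of a relation $Rr\subseteq FX\times FY$ to every relation $r\subseteq X\times Y$; given coalgebras $\alpha\colon X\to FX$, $\beta\colon Y\to FY$, a relation $r\subseteq X\times Y$ is an $R$-(bi)simulation if $r\le \beta^\circ\cdot Rr\cdot\alpha$, and $R$-(bi)similarity is the greatest such relation. It is sound if it is contained in behavioural equivalence (states identified by some pair of coalgebra morphisms into a common coalgebra) and complete if it contains behavioural equivalence. $F$ preserves 1/4-iso pullbacks if it preserves pullbacks of a map along an isomorphism. A relation is difunctional if it is of the form $g^\circ\cdot f$ for functions $f\colon X\to O$, $g\colon Y\to O$; $\hat r$ denotes the difunctional closure (least difunctional relation containing $r$). The coBarr relator $\underline{F}$ sends $r$ to $(Fg)^\circ\cdot Ff$ where $\hat r=g^\circ\cdot f$ (well defined when $F$ preserves 1/4-iso pullbacks). The Barr relator $\overline{F}$ sends $r=\pi_2\cdot\pi_1^\circ$ (for a span $\pi_1\colon A\to X$, $\pi_2\colon A\to Y$) to $F\pi_2\cdot(F\pi_1)^\circ$. An $\overline{F}$-bisimulation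 up to difunctionality is a relation $r$ with $r\le\beta^\circ\cdot\overline{F}(\hat r)\cdot\alpha$. -}

module Defs where

open import Level using (Level; _⊔_; 0ℓ) renaming (suc to lsuc)
open import Function using (_∘_; id; _⇔_)
open import Data.Product using (Σ; Σ-syntax; ∃; _×_; _,_; proj₁; proj₂)
open import Relation.Nullary using (Dec)
open import Relation.Binary.PropositionalEquality using (_≡_)
open import Relation.Binary.Structures using (IsEquivalence)

record Functor : Set₁ where
  field
    F₀     : Set → Set
    fmap   : {A B : Set} → (A → B) → F₀ A → F₀ B
    fmap-id : {A : Set} (u : F₀ A) → fmap id u ≡ u
    fmap-∘  : {A B C : Set} (g : B → C) (f : A → B) (u : F₀ A) →
              fmap (g ∘ f) u ≡ fmap g (fmap f u)

Rel : Set → Set → (ℓ : Level) → Set (lsuc ℓ)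
Rel X Y ℓ = X → Y → Set ℓ

_·_ : {X Y Z : Set} {ℓ₁ ℓ₂ : Level} → Rel Y Z ℓ₂ → Rel X Y ℓ₁ → Rel X Z (ℓ₁ ⊔ ℓ₂)
(s · r) x z = Σ[ y ∈ _ ] (r x y × s y z)
infixr 9 _·_

_° : {X Y : Set} {ℓ : Level} → Rel X Y ℓ → Rel Y X ℓ
(r °) y x = r x y

⟦_⟧ : {X Y : Set} → (X → Y) → Rel X Y 0ℓ
⟦ f ⟧ x y = f x ≡ y

_⊆_ : {X Y : Set} {ℓ₁ ℓ₂ : Level} → Rel X Y ℓ₁ → Rel X Y ℓ₂ → Set (ℓ₁ ⊔ ℓ₂)
r ⊆ s = ∀ x y → r x y → s x y

IsIso : {A B : Set} → (A → B) → Set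
IsIso {A} {B} f = Σ[ g ∈ (B → A) ] ((∀ a → g (f a) ≡ a) × (∀ b → f (g b) ≡ b))

record Square : Set₁ where
  field
    {P A B C} : Set
    p₁ : P → A
    p₂ : P → B
    f  : A → C
    g  : B → C

IsPullback : Square → Set
IsPullback sq = (∀ p → f (p₁ p) ≡ g (p₂ p))
              × (∀ a b → f a ≡ g b →
                   Σ[ p ∈ P ] ((p₁ p ≡ a × p₂ p ≡ b)
                     × (∀ p' → p₁ p' ≡ a → p₂ p' ≡ b → p' ≡ p)))
  where open Square sq

IsWeakPullback : Square → Set
IsWeakPullback sq = (∀ p → f (p₁ p) ≡ g (p₂ p))
                  × (∀ a b → f a ≡ g b → Σ[ p ∈ P ] (p₁ p ≡ a × p₂ p ≡ b))
  where open Square sq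

mapSquare : Functor → Square → Square
mapSquare F sq = record { p₁ = fmap p₁ ; p₂ = fmap p₂ ; f = fmap f ; g = fmap g }
  where open Square sq ; open Functor F

OneQuarterIso : Square → Set
OneQuarterIso sq = (IsIso p₁ Data.Sum.⊎ IsIso p₂) Data.Sum.⊎ (IsIso f Data.Sum.⊎ IsIso g)
  where open Square sq
        import Data.Sum

Preserves¼IsoPullbacks : Functor → Set₁
Preserves¼IsoPullbacks F =
  (sq : Square) → OneQuarterIso sq → IsPullback sq → IsPullback (mapSquare F sq)

WeaklyPreservesPullbacks : Functor → Set₁
WeaklyPreservesPullbacks F =
  (sq : Square) → IsPullback sq → IsWeakPullback (mapSquare F sq)

Difunctional : {X Y : Set} → Rel X Y 0ℓ → Set₁
Difunctional {X} {Y} r =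
  Σ[ O ∈ Set ] Σ[ f ∈ (X → O) ] Σ[ g ∈ (Y → O) ] (r ⊆ (⟦ g ⟧ ° · ⟦ f ⟧) × (⟦ g ⟧ ° · ⟦ f ⟧) ⊆ r)

IsDifClosure : {X Y : Set} → Rel X Y 0ℓ → Rel X Y 0ℓ → Set₁
IsDifClosure {X} {Y} r s =
  Difunctional s × r ⊆ s × ((t : Rel X Y 0ℓ) → Difunctional t → r ⊆ t → s ⊆ t)

module _ (F : Functor) where
  open Functor F

  Barr : {X Y : Set} → Rel X Y 0ℓ → Rel (F₀ X) (F₀ Y) 0ℓ
  Barr {X} {Y} r = ⟦ fmap π₂ ⟧ · (⟦ fmap π₁ ⟧ °)
    where
      T = Σ[ x ∈ X ] Σ[ y ∈ Y ] r x y
      π₁ : T → X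
      π₁ (x , _ , _) = x
      π₂ : T → Y
      π₂ (_ , y , _) = y

  coBarr : {X Y : Set} → Rel X Y 0ℓ → Rel (F₀ X) (F₀ Y) (lsuc 0ℓ)
  coBarr {X} {Y} r u v =
    Σ[ O ∈ Set ] Σ[ f ∈ (X → O) ] Σ[ g ∈ (Y → O) ]
      (IsDifClosure r (⟦ g ⟧ ° · ⟦ f ⟧) × (⟦ fmap g ⟧ ° · ⟦ fmap f ⟧) u v)

  record Coalg : Set₁ where
    constructor coalg
    field
      Carrier : Set
      str     : Carrier → F₀ Carrier

  IsMorphism : (A B : Coalg) → (Coalg.Carrier A → Coalg.Carrier B) → Set
  IsMorphism A B h = ∀ x → Coalg.str B (h x) ≡ fmap h (Coalg.str A x)

  BehEq : (A B : Coalg) → Rel (Coalg.Carrier A) (Coalg.Carrier B) (lsuc 0ℓ)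
  BehEq A B x y =
    Σ[ C ∈ Coalg ] Σ[ h ∈ (Coalg.Carrier A → Coalg.Carrier C) ]
    Σ[ k ∈ (Coalg.Carrier B → Coalg.Carrier C) ]
      (IsMorphism A C h × IsMorphism B C k × h x ≡ k y)

  IsBisim : {ℓ : Level} → (R : {X Y : Set} → Rel X Y 0ℓ → Rel (F₀ X) (F₀ Y) ℓ) →
            (A B : Coalg) → Rel (Coalg.Carrier A) (Coalg.Carrier B) 0ℓ → Set ℓ
  IsBisim R A B r = r ⊆ ((⟦ Coalg.str B ⟧ °) · R r · ⟦ Coalg.str A ⟧)

  Bisimilar : {ℓ : Level} → (R : {X Y : Set} → Rel X Y 0ℓ → Rel (F₀ X) (F₀ Y) ℓ) →
              (A B : Coalg) → Rel (Coalg.Carrier A) (Coalg.Carrier B) (lsuc 0ℓ ⊔ ℓ)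
  Bisimilar R A B x y = Σ[ r ∈ Rel (Coalg.Carrier A) (Coalg.Carrier B) 0ℓ ] (IsBisim R A B r × r x y)

  IsBarrBisimUpToDif : (A B : Coalg) → Rel (Coalg.Carrier A) (Coalg.Carrier B) 0ℓ → Set₁
  IsBarrBisimUpToDif A B r =
    Σ[ s ∈ Rel (Coalg.Carrier A) (Coalg.Carrier B) 0ℓ ]
      (IsDifClosure r s × r ⊆ ((⟦ Coalg.str B ⟧ °) · Barr s · ⟦ Coalg.str A ⟧))

-- Classical set-theoretic background (ambient metatheory of the paper):
-- excluded middle, and quotients of Set by equivalence relations with a
-- choice of representatives.

record Quotient (A : Set) (R : A → A → Set) : Set₁ where
  field
    Q       : Set
    [_]     : A → Q
    sound   : ∀ a b → R a b → [ a ] ≡ [ b ]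
    exact   : ∀ a b → [ a ] ≡ [ b ] → R a b
    rep     : Q → A
    rep-sec : ∀ z → [ rep z ] ≡ z

record ClassicalSet : Set₁ where
  field
    lem       : (P : Set) → Dec P
    quotients : (A : Set) (R : A → A → Set) → IsEquivalence R → Quotient A R

-- Preservation of 1/4-iso pullbacks yields two facts: F respects pointwise equality of maps,
-- and F preserves "k is injective over the image of h" (the square h, id, k, k ∘ h is a
-- pullback). From these, (F g)° · F f is monotone in g° · f, so the coBarr relator depends
-- only on the difunctional closure. The key is to refine the cospan (f, g), giving every
-- element without a partner on the other side a point of its own: F f u = F g v lifts to the
-- refinement, and g° · f ⊆ g'° · f' makes f' and g' factor through it.
-- Soundness: for a coBarr-bisimulation with closure g° · f, the refinement of (f, g) carries a
-- coalgebra for which both refined maps are morphisms. Completeness: the kernel g° · f of two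
-- morphisms into a common coalgebra is a difunctional coBarr-bisimulation. For (2), the
-- tabulation of g° · f is a pullback of f and g, so if F weakly preserves pullbacks then
-- F f u = F g v has a Barr witness for g° · f; the converse needs only functoriality.
module Submission where

open import Defs
open import Level using (Level; 0ℓ)
open import Axiom.UniquenessOfIdentityProofs.WithK using (uip)
open import Data.Empty using (⊥-elim)
open import Data.Product using (_×_; Σ-syntax; _,_; proj₁; proj₂)
open import Data.Sum using (_⊎_; inj₁; inj₂)
open import Data.Sum.Properties using (inj₁-injective; inj₂-injective)
open import Data.Unit using (⊤; tt)
open import Function using (_⇔_; _∘_; id)
open import Function.Bundles using (mk⇔)
open import Relation.Nullary using (Dec; yes; no; ¬_)
open import Relation.Binary.PropositionalEquality
  using (_≡_; _≗_; refl; sym; trans; cong; module ≡-Reasoning)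

PullbackRel : {X Y O : Set} → (X → O) → (Y → O) → Rel X Y 0ℓ
PullbackRel f g x y = f x ≡ g y

private
  variable
    X Y O Z : Set
    r s : Rel X Y 0ℓ

cospan⇒pullbackRel : {f : X → O} {g : Y → O} → (⟦ g ⟧ ° · ⟦ f ⟧) ⊆ PullbackRel f g
cospan⇒pullbackRel _ _ (_ , fx≡o , gy≡o) = trans fx≡o (sym gy≡o)

pullbackRel⇒cospan : {f : X → O} {g : Y → O} → PullbackRel f g ⊆ (⟦ g ⟧ ° · ⟦ f ⟧)
pullbackRel⇒cospan {f = f} x _ fx≡gy = f x , refl , sym fx≡gy

cospan-difunctional : {f : X → O} {g : Y → O} → Difunctional (⟦ g ⟧ ° · ⟦ f ⟧)
cospan-difunctional {f = f} {g = g} = _ , f , g , (λ _ _ p → p) , (λ _ _ p → p)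

cospan-isDifClosure : {f : X → O} {g : Y → O} → IsDifClosure (⟦ g ⟧ ° · ⟦ f ⟧) (⟦ g ⟧ ° · ⟦ f ⟧)
cospan-isDifClosure = cospan-difunctional , (λ _ _ p → p) , (λ _ _ r⊆t → r⊆t)

module _ {f : X → O} {g : Y → O} (closure : IsDifClosure r (⟦ g ⟧ ° · ⟦ f ⟧)) where

  cospanClosure-⊇ : r ⊆ PullbackRel f g
  cospanClosure-⊇ x y rxy = cospan⇒pullbackRel {f = f} {g = g} x y (proj₁ (proj₂ closure) x y rxy)

  cospanClosure-least : {a : X → Z} {b : Y → Z} →
                        r ⊆ PullbackRel a b → PullbackRel f g ⊆ PullbackRel a b
  cospanClosure-least {a = a} {b = b} r⊆ab x y fx≡gy =
    cospan⇒pullbackRel {f = a} {g = b} x y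
      (proj₂ (proj₂ closure) _ cospan-difunctional
        (λ x' y' rx'y' → pullbackRel⇒cospan {f = a} {g = b} x' y' (r⊆ab x' y' rx'y'))
        x y (pullbackRel⇒cospan {f = f} {g = g} x y fx≡gy))

isDifClosure-resp : {s' : Rel X Y 0ℓ} →
                    s ⊆ s' → s' ⊆ s → IsDifClosure r s → IsDifClosure r s'
isDifClosure-resp s⊆s' s'⊆s ((O , f , g , s⊆gf , gf⊆s) , r⊆s , least) =
  (O , f , g , (λ x y → s⊆gf x y ∘ s'⊆s x y) , (λ x y → s⊆s' x y ∘ gf⊆s x y)) ,
  (λ x y → s⊆s' x y ∘ r⊆s x y) ,
  (λ t dt r⊆t x y → least t dt r⊆t x y ∘ s'⊆s x y)

empty-isDifClosure : (∀ x y → ¬ r x y) →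
                     IsDifClosure r (⟦ inj₂ {A = X} ⟧ ° · ⟦ inj₁ {B = Y} ⟧)
empty-isDifClosure r-empty =
  cospan-difunctional ,
  (λ x y rxy → ⊥-elim (r-empty x y rxy)) ,
  (λ { _ _ _ _ _ (_ , refl , ()) })

InjectiveOver : {Q Q' : Set} → (Q → Q') → (Y → Q) → Set
InjectiveOver {Y = Y} k h = ∀ a (b : Y) → k a ≡ k (h b) → a ≡ h b

module Refinement (lem : (P : Set) → Dec P) {X Y O : Set} (f : X → O) (g : Y → O) where

  Partnerˡ : X → Set
  Partnerˡ x = Σ[ y ∈ Y ] f x ≡ g y

  Partnerʳ : Y → Set
  Partnerʳ y = Σ[ x ∈ X ] f x ≡ g y

  Loneˡ Loneʳ Refined : Set
  Loneˡ = Σ[ x ∈ X ] ¬ Partnerˡ x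
  Loneʳ = Σ[ y ∈ Y ] ¬ Partnerʳ y
  Refined = O ⊎ (Loneˡ ⊎ Loneʳ)

  refineˡ : (x : X) → Dec (Partnerˡ x) → Refined
  refineˡ x (yes _)  = inj₁ (f x)
  refineˡ x (no ¬p)  = inj₂ (inj₁ (x , ¬p))

  refineʳ : (y : Y) → Dec (Partnerʳ y) → Refined
  refineʳ y (yes _)  = inj₁ (g y)
  refineʳ y (no ¬p)  = inj₂ (inj₂ (y , ¬p))

  f⁺ : X → Refined
  f⁺ x = refineˡ x (lem (Partnerˡ x))

  g⁺ : Y → Refined
  g⁺ y = refineʳ y (lem (Partnerʳ y))

  pullbackRel-⊆-refined : PullbackRel f g ⊆ PullbackRel f⁺ g⁺
  pullbackRel-⊆-refined x y fx≡gy with lem (Partnerˡ x) | lem (Partnerʳ y)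
  ... | yes _  | yes _  = cong inj₁ fx≡gy
  ... | no ¬p  | _      = ⊥-elim (¬p (y , fx≡gy))
  ... | yes _  | no ¬p  = ⊥-elim (¬p (x , fx≡gy))

  module Factorisation {Z : Set} (z : Z) (a : X → Z) (b : Y → Z)
                       (compat : PullbackRel f g ⊆ PullbackRel a b) where

    -- z is only reached on points of O that neither f⁺ nor g⁺ hits.
    choose : (o : O) → Dec (Σ[ x ∈ X ] f x ≡ o) → Dec (Σ[ y ∈ Y ] g y ≡ o) → Z
    choose o (yes (x , _)) _             = a x
    choose o (no _)        (yes (y , _)) = b y
    choose o (no _)        (no _)        = z

    factor : Refined → Z
    factor (inj₁ o)              = choose o (lem _) (lem _)
    factor (inj₂ (inj₁ (x , _))) = a x
    factor (inj₂ (inj₂ (y , _))) = b y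

    choose-f : ∀ x y → f x ≡ g y → ∀ dx dy → choose (f x) dx dy ≡ a x
    choose-f x y fx≡gy (yes (x' , fx'≡fx)) _ =
      trans (compat x' y (trans fx'≡fx fx≡gy)) (sym (compat x y fx≡gy))
    choose-f x y _     (no ¬p) _ = ⊥-elim (¬p (x , refl))

    choose-g : ∀ x y → f x ≡ g y → ∀ dx dy → choose (g y) dx dy ≡ b y
    choose-g x y _     (yes (x' , fx'≡gy)) _ = compat x' y fx'≡gy
    choose-g x y fx≡gy (no ¬p) _ = ⊥-elim (¬p (x , fx≡gy))

    factor∘f⁺ : factor ∘ f⁺ ≗ a
    factor∘f⁺ x with lem (Partnerˡ x)
    ... | yes (y , fx≡gy) = choose-f x y fx≡gy (lem _) (lem _)
    ... | no _            = refl

    factor∘g⁺ : factor ∘ g⁺ ≗ b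
    factor∘g⁺ y with lem (Partnerʳ y)
    ... | yes (x , fx≡gy) = choose-g x y fx≡gy (lem _) (lem _)
    ... | no _            = refl

  collapseʳ : O ⊎ Loneʳ → O
  collapseʳ (inj₁ o)       = o
  collapseʳ (inj₂ (y , _)) = g y

  collapseˡ : Refined → O ⊎ Loneʳ
  collapseˡ (inj₁ o)              = inj₁ o
  collapseˡ (inj₂ (inj₁ (x , _))) = inj₁ (f x)
  collapseˡ (inj₂ (inj₂ l))       = inj₂ l

  collapseˡ∘f⁺ : collapseˡ ∘ f⁺ ≗ inj₁ ∘ f
  collapseˡ∘f⁺ x with lem (Partnerˡ x)
  ... | yes _ = refl
  ... | no _  = refl

  collapse∘g⁺ : collapseʳ ∘ collapseˡ ∘ g⁺ ≗ g
  collapse∘g⁺ y with lem (Partnerʳ y)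
  ... | yes _ = refl
  ... | no _  = refl

  collapseʳ-injectiveOver : InjectiveOver collapseʳ (inj₁ ∘ f)
  collapseʳ-injectiveOver (inj₁ o)        _ o≡fx  = cong inj₁ o≡fx
  collapseʳ-injectiveOver (inj₂ (y , ¬p)) x gy≡fx = ⊥-elim (¬p (x , sym gy≡fx))

  collapseˡ-injectiveOver : InjectiveOver collapseˡ g⁺
  -- The omitted cases are those where e equates distinct constructors.
  collapseˡ-injectiveOver a y e with lem (Partnerʳ y) | a
  ... | yes _ | inj₁ _               = cong inj₁ (inj₁-injective e)
  ... | yes _ | inj₂ (inj₁ (_ , ¬p)) = ⊥-elim (¬p (y , inj₁-injective e))
  ... | no _  | inj₂ (inj₂ _)        = cong (inj₂ ∘ inj₂) (inj₂-injective e)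

cospanTabulation : (X → O) → (Y → O) → Square
cospanTabulation {X = X} {Y = Y} f g = record
  { P = Σ[ x ∈ X ] Σ[ y ∈ Y ] (⟦ g ⟧ ° · ⟦ f ⟧) x y
  ; p₁ = proj₁ ; p₂ = proj₁ ∘ proj₂ ; f = f ; g = g }

cospanTabulation-isPullback : (f : X → O) (g : Y → O) → IsPullback (cospanTabulation f g)
cospanTabulation-isPullback f g =
  (λ (x , y , fx≡o≡gy) → cospan⇒pullbackRel {f = f} {g = g} x y fx≡o≡gy) ,
  λ x y fx≡gy → (x , y , pullbackRel⇒cospan {f = f} {g = g} x y fx≡gy) , (refl , refl) , unique fx≡gy
  where
    unique : ∀ {x y} (fx≡gy : f x ≡ g y) (t : Square.P (cospanTabulation f g)) →
             proj₁ t ≡ x → proj₁ (proj₂ t) ≡ y → t ≡ (x , y , f x , refl , sym fx≡gy)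
    unique fx≡gy (x , y , _ , refl , gy≡fx) refl refl =
      cong (λ e → x , y , f x , refl , e) (uip gy≡fx (sym fx≡gy))

step-mono : {U V : Set} {α : X → U} {β : Y → V} {ℓ ℓ' : Level} {R : Rel U V ℓ} {R' : Rel U V ℓ'} →
            R ⊆ R' → r ⊆ (⟦ β ⟧ ° · R · ⟦ α ⟧) → r ⊆ (⟦ β ⟧ ° · R' · ⟦ α ⟧)
step-mono R⊆R' r-step x y rxy with r-step x y rxy
... | v , (u , αx≡u , Ruv) , βy≡v = v , (u , αx≡u , R⊆R' u v Ruv) , βy≡v

module _ (F : Functor) where
  open Functor F
  open Coalg using (Carrier; str)

  fmap≡⇒coBarr : {f : X → O} {g : Y → O} → IsDifClosure r (⟦ g ⟧ ° · ⟦ f ⟧) →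
                 PullbackRel (fmap f) (fmap g) ⊆ coBarr F r
  fmap≡⇒coBarr {f = f} {g = g} closure u v Ffu≡Fgv =
    _ , f , g , closure , pullbackRel⇒cospan {f = fmap f} {g = fmap g} u v Ffu≡Fgv

  fmap≡⇒Barr : WeaklyPreservesPullbacks F → {f : X → O} {g : Y → O} →
               PullbackRel (fmap f) (fmap g) ⊆ Barr F (⟦ g ⟧ ° · ⟦ f ⟧)
  fmap≡⇒Barr wpp {f = f} {g = g} =
    proj₂ (wpp (cospanTabulation f g) (cospanTabulation-isPullback f g))

  successors : {ℓ : Level} (R : {X Y : Set} → Rel X Y 0ℓ → Rel (F₀ X) (F₀ Y) ℓ) {A B : Coalg F}
               {r : Rel (Carrier A) (Carrier B) 0ℓ} → IsBisim F R A B r →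
               ∀ x y → r x y → R r (str A x) (str B y)
  successors _ bisim x y rxy with bisim x y rxy
  ... | _ , (_ , refl , Rr) , refl = Rr

  module _ (pres : Preserves¼IsoPullbacks F) where

    private
      id-isIso : IsIso (id {A = X})
      id-isIso = id , (λ _ → refl) , (λ _ → refl)

    fmap-cong : {h h' : X → Y} → h ≗ h' → fmap h ≗ fmap h'
    fmap-cong {h = h} {h' = h'} h≗h' u = begin
      fmap h u            ≡⟨ fmap-id (fmap h u) ⟨
      fmap id (fmap h u)  ≡⟨ proj₁ (pres square (inj₁ (inj₁ id-isIso)) isPullback) u ⟨
      fmap h' (fmap id u) ≡⟨ cong (fmap h') (fmap-id u) ⟩
      fmap h' u           ∎
      where
        open ≡-Reasoning
        -- a pullback since h ≗ h'; only the commutativity of its image under F is used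
        square : Square
        square = record { p₁ = id ; p₂ = h ; f = h' ; g = id }
        isPullback : IsPullback square
        isPullback = (λ x → sym (h≗h' x)) ,
                     λ x y h'x≡y → x , (refl , trans (h≗h' x) h'x≡y) , λ _ x'≡x _ → x'≡x

    fmap-injectiveOver : {Q Q' : Set} {k : Q → Q'} {h : Y → Q} →
                         InjectiveOver k h → InjectiveOver (fmap k) (fmap h)
    fmap-injectiveOver {k = k} {h = h} k-inj a b Fka≡Fkhb
      with proj₂ (pres square (inj₁ (inj₂ id-isIso)) isPullback) a b
             (trans Fka≡Fkhb (sym (fmap-∘ k h b)))
      where
        -- the pullback of k along k ∘ h is h itself
        square : Square
        square = record { p₁ = h ; p₂ = id ; f = k ; g = k ∘ h }
        isPullback : IsPullback square
        isPullback = (λ _ → refl) ,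
                     λ a b ka≡khb → b , (sym (k-inj a b ka≡khb) , refl) , λ _ _ b'≡b → b'≡b
    ... | w , (Fhw≡a , Fidw≡b) , _ =
      trans (sym Fhw≡a) (cong (fmap h) (trans (sym (fmap-id w)) Fidw≡b))

    Barr⇒fmap≡ : {f : X → O} {g : Y → O} → s ⊆ PullbackRel f g →
                 Barr F s ⊆ PullbackRel (fmap f) (fmap g)
    Barr⇒fmap≡ {f = f} {g = g} s⊆fg _ _ (w , refl , refl) = begin
      fmap f (fmap proj₁ w)            ≡⟨ fmap-∘ f proj₁ w ⟨
      fmap (f ∘ proj₁) w               ≡⟨ fmap-cong (λ (x , y , sxy) → s⊆fg x y sxy) w ⟩
      fmap (g ∘ proj₁ ∘ proj₂) w       ≡⟨ fmap-∘ g (proj₁ ∘ proj₂) w ⟩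
      fmap g (fmap (proj₁ ∘ proj₂) w)  ∎
      where open ≡-Reasoning

    module _ (lem : (P : Set) → Dec P) where

      -- Unmatched elements of Y are separated first (collapseʳ), then those of X (collapseˡ);
      -- at each stage F reflects the separation because the collapse is injective over it.
      fmap-pullbackRel-⊆-refined : (f : X → O) (g : Y → O) → let open Refinement lem f g in
                                   PullbackRel (fmap f) (fmap g) ⊆ PullbackRel (fmap f⁺) (fmap g⁺)
      fmap-pullbackRel-⊆-refined f g u v Ffu≡Fgv =
        fmap-injectiveOver collapseˡ-injectiveOver (fmap f⁺ u) v collapsed
        where
          open Refinement lem f g
          open ≡-Reasoning
          collapsed-g⁺ : fmap (collapseˡ ∘ g⁺) v ≡ fmap (inj₁ ∘ f) u
          collapsed-g⁺ = fmap-injectiveOver collapseʳ-injectiveOver _ u (begin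
            fmap collapseʳ (fmap (collapseˡ ∘ g⁺) v) ≡⟨ fmap-∘ collapseʳ (collapseˡ ∘ g⁺) v ⟨
            fmap (collapseʳ ∘ collapseˡ ∘ g⁺) v      ≡⟨ fmap-cong collapse∘g⁺ v ⟩
            fmap g v                                 ≡⟨ Ffu≡Fgv ⟨
            fmap (collapseʳ ∘ inj₁ ∘ f) u            ≡⟨ fmap-∘ collapseʳ (inj₁ ∘ f) u ⟩
            fmap collapseʳ (fmap (inj₁ ∘ f) u)       ∎)
          collapsed : fmap collapseˡ (fmap f⁺ u) ≡ fmap collapseˡ (fmap g⁺ v)
          collapsed = begin
            fmap collapseˡ (fmap f⁺ u)  ≡⟨ fmap-∘ collapseˡ f⁺ u ⟨
            fmap (collapseˡ ∘ f⁺) u     ≡⟨ fmap-cong collapseˡ∘f⁺ u ⟩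
            fmap (inj₁ ∘ f) u           ≡⟨ collapsed-g⁺ ⟨
            fmap (collapseˡ ∘ g⁺) v     ≡⟨ fmap-∘ collapseˡ g⁺ v ⟩
            fmap collapseˡ (fmap g⁺ v)  ∎

      fmap-pullbackRel-mono : {O' : Set} {f : X → O} {g : Y → O} {f' : X → O'} {g' : Y → O'} →
                              PullbackRel f g ⊆ PullbackRel f' g' →
                              PullbackRel (fmap f) (fmap g) ⊆ PullbackRel (fmap f') (fmap g')
      fmap-pullbackRel-mono {f = f} {g = g} {f' = f'} {g' = g'} fg⊆f'g' u v eq =
        fmap-injectiveOver inj₁-injectiveOver (fmap f' u) v (begin
          fmap inj₁ (fmap f' u)   ≡⟨ fmap-∘ inj₁ f' u ⟨
          fmap (inj₁ ∘ f') u      ≡⟨ fmap-cong factor∘f⁺ u ⟨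
          fmap (factor ∘ f⁺) u    ≡⟨ fmap-∘ factor f⁺ u ⟩
          fmap factor (fmap f⁺ u) ≡⟨ cong (fmap factor) (fmap-pullbackRel-⊆-refined f g u v eq) ⟩
          fmap factor (fmap g⁺ v) ≡⟨ fmap-∘ factor g⁺ v ⟨
          fmap (factor ∘ g⁺) v    ≡⟨ fmap-cong factor∘g⁺ v ⟩
          fmap (inj₁ ∘ g') v      ≡⟨ fmap-∘ inj₁ g' v ⟩
          fmap inj₁ (fmap g' v)   ∎)
        where
          open Refinement lem f g
          open ≡-Reasoning
          -- O' may be empty, so the factorisation lands in O' ⊎ ⊤.
          open Factorisation (inj₂ tt) (inj₁ ∘ f') (inj₁ ∘ g')
                             (λ x y fx≡gy → cong inj₁ (fg⊆f'g' x y fx≡gy))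
          inj₁-injectiveOver : InjectiveOver inj₁ g'
          inj₁-injectiveOver _ _ = inj₁-injective

      coBarr⇒fmap≡ : {f : X → O} {g : Y → O} → IsDifClosure r (⟦ g ⟧ ° · ⟦ f ⟧) →
                     coBarr F r ⊆ PullbackRel (fmap f) (fmap g)
      coBarr⇒fmap≡ {f = f} {g = g} closure u v (_ , f' , g' , closure' , Ff'u≡o≡Fg'v) =
        fmap-pullbackRel-mono (cospanClosure-least closure' (cospanClosure-⊇ closure)) u v
          (cospan⇒pullbackRel {f = fmap f'} {g = fmap g'} u v Ff'u≡o≡Fg'v)

      module _ (A B : Coalg F) where

        pullbackRel-bisim⇒behEq : (f : Carrier A → O) (g : Carrier B → O) →
          PullbackRel f g ⊆ PullbackRel (fmap f ∘ str A) (fmap g ∘ str B) →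
          PullbackRel f g ⊆ BehEq F A B
        pullbackRel-bisim⇒behEq f g fg-bisim x₀ y₀ fx₀≡gy₀ =
          coalg Refined factor , f⁺ , g⁺ , factor∘f⁺ , factor∘g⁺ ,
          pullbackRel-⊆-refined x₀ y₀ fx₀≡gy₀
          where
            open Refinement lem f g
            open Factorisation (fmap f⁺ (str A x₀)) (fmap f⁺ ∘ str A) (fmap g⁺ ∘ str B)
              (λ x y fx≡gy → fmap-pullbackRel-⊆-refined f g _ _ (fg-bisim x y fx≡gy))

        coBarr-sound : Bisimilar F (coBarr F) A B ⊆ BehEq F A B
        coBarr-sound x y (r , bisim , rxy) with successors (coBarr F) bisim x y rxy
        ... | _ , f , g , closure , _ =
          pullbackRel-bisim⇒behEq f g
            (cospanClosure-least closure λ x' y' rx'y' →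
               coBarr⇒fmap≡ closure _ _ (successors (coBarr F) bisim x' y' rx'y'))
            x y (cospanClosure-⊇ closure x y rxy)

        coBarr-complete : BehEq F A B ⊆ Bisimilar F (coBarr F) A B
        coBarr-complete x₀ y₀ (D , h , k , h-morphism , k-morphism , hx₀≡ky₀) =
          ⟦ k ⟧ ° · ⟦ h ⟧ , bisim , pullbackRel⇒cospan {f = h} {g = k} x₀ y₀ hx₀≡ky₀
          where
            open ≡-Reasoning
            bisim : IsBisim F (coBarr F) A B (⟦ k ⟧ ° · ⟦ h ⟧)
            bisim x y hk = _ , (_ , refl , fmap≡⇒coBarr cospan-isDifClosure _ _ (begin
              fmap h (str A x)  ≡⟨ h-morphism x ⟨
              str D (h x)       ≡⟨ cong (str D) (cospan⇒pullbackRel {f = h} {g = k} x y hk) ⟩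
              str D (k y)       ≡⟨ k-morphism y ⟩
              fmap k (str B y)  ∎)) , refl

        coBarrBisim-difClosure : IsBisim F (coBarr F) A B r →
          Σ[ O ∈ Set ] Σ[ f ∈ (Carrier A → O) ] Σ[ g ∈ (Carrier B → O) ]
            IsDifClosure r (⟦ g ⟧ ° · ⟦ f ⟧)
        coBarrBisim-difClosure {r = r} bisim with lem (Σ[ x ∈ Carrier A ] Σ[ y ∈ Carrier B ] r x y)
        ... | no r-empty = _ , inj₁ , inj₂ , empty-isDifClosure λ x y rxy → r-empty (x , y , rxy)
        ... | yes (x , y , rxy) with successors (coBarr F) bisim x y rxy
        ...   | O , f , g , closure , _ = O , f , g , closure

        coBarrBisim⇒barrBisimUpToDif : WeaklyPreservesPullbacks F →
                                       IsBisim F (coBarr F) A B r → IsBarrBisimUpToDif F A B r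
        coBarrBisim⇒barrBisimUpToDif wpp bisim with coBarrBisim-difClosure bisim
        ... | _ , f , g , closure =
          ⟦ g ⟧ ° · ⟦ f ⟧ , closure ,
          step-mono (λ u v → fmap≡⇒Barr wpp u v ∘ coBarr⇒fmap≡ closure u v) bisim

        barrBisimUpToDif⇒coBarrBisim : IsBarrBisimUpToDif F A B r → IsBisim F (coBarr F) A B r
        barrBisimUpToDif⇒coBarrBisim (s , closure@((_ , f , g , s⊆gf , gf⊆s) , _) , up-to-dif) =
          step-mono (λ u v → fmap≡⇒coBarr closure' u v ∘ Barr⇒fmap≡ s⊆fg u v) up-to-dif
          where
            closure' : IsDifClosure _ (⟦ g ⟧ ° · ⟦ f ⟧)
            closure' = isDifClosure-resp s⊆gf gf⊆s closure
            s⊆fg : s ⊆ PullbackRel f g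
            s⊆fg x y sxy = cospan⇒pullbackRel {f = f} {g = g} x y (s⊆gf x y sxy)

corollary7 : ClassicalSet → (F : Functor) → Preserves¼IsoPullbacks F →
    ((A B : Coalg F) → Bisimilar F (coBarr F) A B ⊆ BehEq F A B
                     × BehEq F A B ⊆ Bisimilar F (coBarr F) A B)
    × (WeaklyPreservesPullbacks F →
        (A B : Coalg F) (r : Rel (Coalg.Carrier A) (Coalg.Carrier B) 0ℓ) →
          IsBisim F (coBarr F) A B r ⇔ IsBarrBisimUpToDif F A B r)
corollary7 classical F pres =
  (λ A B → coBarr-sound F pres lem A B , coBarr-complete F pres lem A B) ,
  (λ wpp A B r → mk⇔ (coBarrBisim⇒barrBisimUpToDif F pres lem A B wpp)
                     (barrBisimUpToDif⇒coBarrBisim F pres lem A B))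
  where open ClassicalSet classical using (lem)
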